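{- For a $k$-uniform hypergraph $G(V,E)$, $\chi(G)\ge \frac{|V|}{2\gamma(G)}$.
   Context: $\chi(G)$ is the minimum number of colors in a vertex coloring of $G$ with no monochromatic hyperedge. A bicoloring of $G$ is a map $X:V\to\{0,1\}$; a bicoloring cover of $G$ is a set of bicolorings such that every hyperedge is non-monochromatic under at least one of them; $\chi^c(G)$ is the minimum size of a bicoloring cover. For an optimal bicoloring cover $C=\{X_1,\dots,X_{\chi^c(G)}\}$, each vertex $v$ gets the color bit vector $(X_1(v),\dots,X_{\chi^c(G)}(v))$, and $\gamma_C(G)$ is the maximum number of vertices sharing a common bit vector. The cover independence number $\gamma(G)$ is the maximum of $\gamma_C(G)$ over all bicoloring covers $C$ of size $\chi^c(G)$. -}

module Defs where

open import Data.Nat using (ℕ; _≤_)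
open import Data.Bool using (Bool)
import Data.Bool.Properties as BoolP
open import Data.Fin using (Fin)
open import Data.Fin.Subset using (Subset; _∈_; ∣_∣)
open import Data.Vec using (Vec; tabulate)
open import Data.Vec.Properties using (≡-dec)
open import Data.List using (List)
open import Data.List.Relation.Unary.All using (All)
open import Data.Product using (Σ; ∃; _×_)
open import Relation.Nullary using (¬_; does)
open import Relation.Binary.PropositionalEquality using (_≡_)

record Hypergraph (n : ℕ) : Set where
  constructor hypergraph
  field
    edges : List (Subset n)
open Hypergraph public

Uniform : ∀ {n} → ℕ → Hypergraph n → Set
Uniform k G = All (λ e → ∣ e ∣ ≡ k) (edges G)

Monochromatic : ∀ {n} {C : Set} → (Fin n → C) → Subset n → Set
Monochromatic f e = ∀ u v → u ∈ e → v ∈ e → f u ≡ f v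

IsMin : (ℕ → Set) → ℕ → Set
IsMin P m = P m × (∀ m′ → P m′ → m ≤ m′)

IsMax : (ℕ → Set) → ℕ → Set
IsMax P m = P m × (∀ m′ → P m′ → m′ ≤ m)

ProperColoring : ∀ {n} → Hypergraph n → ℕ → Set
ProperColoring {n} G c =
  Σ (Fin n → Fin c) λ f → All (λ e → ¬ Monochromatic f e) (edges G)

IsChromaticNumber : ∀ {n} → Hypergraph n → ℕ → Set
IsChromaticNumber G = IsMin (ProperColoring G)

Bicoloring : ℕ → Set
Bicoloring n = Fin n → Bool

Family : ℕ → ℕ → Set
Family n t = Fin t → Bicoloring n

IsBicoloringCover : ∀ {n t} → Hypergraph n → Family n t → Set
IsBicoloringCover G X =
  All (λ e → ∃ λ i → ¬ Monochromatic (X i) e) (edges G)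

HasCoverOfSize : ∀ {n} → Hypergraph n → ℕ → Set
HasCoverOfSize {n} G t = Σ (Family n t) (IsBicoloringCover G)

IsCoverNumber : ∀ {n} → Hypergraph n → ℕ → Set
IsCoverNumber G = IsMin (HasCoverOfSize G)

bitVector : ∀ {n t} → Family n t → Fin n → Vec Bool t
bitVector X v = tabulate (λ i → X i v)

classSize : ∀ {n t} → Family n t → Vec Bool t → ℕ
classSize X b = ∣ tabulate (λ v → does (≡-dec BoolP._≟_ (bitVector X v) b)) ∣

IsGammaC : ∀ {n t} → Family n t → ℕ → Set
IsGammaC {t = t} X = IsMax (λ g → Σ (Vec Bool t) λ b → classSize X b ≡ g)

-- γ(G): maximum of γ_C(G) over bicoloring covers C of size t = χᶜ(G).
IsCoverIndependence : ∀ {n} → Hypergraph n → ℕ → ℕ → Set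
IsCoverIndependence {n} G t =
  IsMax (λ g → Σ (Family n t) λ X → IsBicoloringCover G X × IsGammaC X g)

module Submission where

-- Let t = χᶜ(G) and fix a cover X₁ … X_t realising γ = γ(G).  The proof
-- combines two bounds.
--
-- Every vertex carries one of the 2ᵗ bit vectors and each
--    bit vector is shared by at most γ vertices, so n ≤ 2ᵗ · γ.  If χ ≤ 2ˢ, write the colour of each vertex of a
--    proper χ-colouring in binary with s digits; digit i gives a
--    bicoloring, and a hyperedge monochromatic under every digit would be
--    monochromatic under the colouring.  Hence χᶜ(G) ≤ s.
--
-- Choosing s with χ ≤ 2ˢ ≤ 2χ gives n ≤ 2ᵗ · γ ≤ 2ˢ · γ ≤ 2χ · γ.

open import Defs
open import Data.Nat using (ℕ; zero; suc; _+_; _*_; _^_; _≤_; _<_; _≤?_; z≤n; s≤s)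
open import Data.Nat.Properties
open import Data.Bool using (Bool; true; false; if_then_else_)
import Data.Bool.Properties as Bool
open import Data.Fin using (Fin; inject≤; finToFun; funToFin; combine)
  renaming (zero to fzero; suc to fsuc)
open import Data.Fin.Properties
  using (2↔Bool; inject≤-injective; funToFin-finToFin; ¬∀⟶∃¬; all?)
open import Data.Fin.Subset using (Subset; ∣_∣)
open import Data.Fin.Subset.Properties using (_∈?_)
open import Data.Vec using (Vec; []; _∷_; tabulate)
open import Data.Vec.Properties using (≡-dec)
open import Data.List using (List; []; _∷_; length)
import Data.List as List
import Data.List.Properties as List
import Data.List.Relation.Unary.All as All
open import Data.Product using (∃; _×_; _,_)
open import Function using (_∘_)
open import Function.Bundles using (Inverse)
open import Relation.Nullary using (¬_; Dec; does; yes; no)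
open import Relation.Nullary.Decidable using (_→-dec_)
open import Relation.Binary.Definitions using (DecidableEquality)
open import Relation.Binary.PropositionalEquality

_≟ᵥ_ : ∀ {t} → DecidableEquality (Vec Bool t)
_≟ᵥ_ = ≡-dec Bool._≟_

occurrences : ∀ {t} → Vec Bool t → List (Vec Bool t) → ℕ
occurrences b [] = 0
occurrences b (x ∷ xs) =
  if does (x ≟ᵥ b) then suc (occurrences b xs) else occurrences b xs

-- There is only one bit vector of length 0, so it occurs everywhere.
occurrences-[] : (xs : List (Vec Bool 0)) → occurrences [] xs ≡ length xs
occurrences-[] [] = refl
occurrences-[] ([] ∷ xs) = cong suc (occurrences-[] xs)

withHead : ∀ {t} → Bool → List (Vec Bool (suc t)) → List (Vec Bool t)
withHead c [] = []
withHead c ((d ∷ v) ∷ xs) =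
  if does (d Bool.≟ c) then v ∷ withHead c xs else withHead c xs

length-withHead : ∀ {t} (xs : List (Vec Bool (suc t))) →
  length xs ≡ length (withHead true xs) + length (withHead false xs)
length-withHead [] = refl
length-withHead ((true ∷ v) ∷ xs) = cong suc (length-withHead xs)
length-withHead ((false ∷ v) ∷ xs) =
  trans (cong suc (length-withHead xs)) (sym (+-suc _ _))

occurrences-withHead : ∀ {t} c (b : Vec Bool t) xs →
  occurrences b (withHead c xs) ≡ occurrences (c ∷ b) xs
occurrences-withHead c b [] = refl
occurrences-withHead c b ((d ∷ v) ∷ xs) with does (d Bool.≟ c)
... | true  = cong (λ k → if does (v ≟ᵥ b) then suc k else k)
                   (occurrences-withHead c b xs)
... | false = occurrences-withHead c b xs

pigeonhole : ∀ t γ (xs : List (Vec Bool t)) →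
  (∀ b → occurrences b xs ≤ γ) → length xs ≤ 2 ^ t * γ
pigeonhole zero γ xs bounded = begin
  length xs        ≡⟨ occurrences-[] xs ⟨
  occurrences [] xs ≤⟨ bounded [] ⟩
  γ                ≡⟨ *-identityˡ γ ⟨
  1 * γ            ∎
  where open ≤-Reasoning
pigeonhole (suc t) γ xs bounded = begin
  length xs                                       ≡⟨ length-withHead xs ⟩
  length (withHead true xs) + length (withHead false xs)
    ≤⟨ +-mono-≤ (pigeonhole t γ (withHead true xs) (boundedTail true))
                (pigeonhole t γ (withHead false xs) (boundedTail false)) ⟩
  2 ^ t * γ + 2 ^ t * γ                           ≡⟨ *-distribʳ-+ γ (2 ^ t) (2 ^ t) ⟨
  (2 ^ t + 2 ^ t) * γ                             ≡⟨ cong (λ k → (2 ^ t + k) * γ) (+-identityʳ (2 ^ t)) ⟨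
  2 ^ suc t * γ                                   ∎
  where
  open ≤-Reasoning
  boundedTail : ∀ c b → occurrences b (withHead c xs) ≤ γ
  boundedTail c b = subst (_≤ γ) (sym (occurrences-withHead c b xs)) (bounded (c ∷ b))

classSize≡occurrences : ∀ {n t} (g : Fin n → Vec Bool t) b →
  ∣ tabulate (λ v → does (g v ≟ᵥ b)) ∣ ≡ occurrences b (List.tabulate g)
classSize≡occurrences {zero} g b = refl
classSize≡occurrences {suc n} g b with does (g fzero ≟ᵥ b)
... | true  = cong suc (classSize≡occurrences (g ∘ fsuc) b)
... | false = classSize≡occurrences (g ∘ fsuc) b

vertex-bound : ∀ {n t} (X : Family n t) γ →
  (∀ b → classSize X b ≤ γ) → n ≤ 2 ^ t * γ
vertex-bound {n} {t} X γ bounded =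
  subst (_≤ 2 ^ t * γ) (List.length-tabulate (bitVector X))
    (pigeonhole t γ (List.tabulate (bitVector X))
      (λ b → subst (_≤ γ) (classSize≡occurrences (bitVector X) b) (bounded b)))

funToFin-cong : ∀ {m n} {f g : Fin m → Fin n} →
  (∀ i → f i ≡ g i) → funToFin f ≡ funToFin g
funToFin-cong {zero} f≗g = refl
funToFin-cong {suc m} f≗g = cong₂ combine (f≗g fzero) (funToFin-cong (f≗g ∘ fsuc))

binary : ∀ {s} → Fin (2 ^ s) → Fin s → Fin 2
binary {s} = finToFun {2} {s}

binary-injective : ∀ {s} (k l : Fin (2 ^ s)) →
  (∀ i → binary {s} k i ≡ binary {s} l i) → k ≡ l
binary-injective {s} k l same = begin
  k                           ≡⟨ funToFin-finToFin {s} {2} k ⟨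
  funToFin (binary {s} k)     ≡⟨ funToFin-cong same ⟩
  funToFin (binary {s} l)     ≡⟨ funToFin-finToFin {s} {2} l ⟩
  l                     ∎
  where open ≡-Reasoning

digit : ∀ {s} → Fin (2 ^ s) → Fin s → Bool
digit {s} k i = Inverse.to 2↔Bool (binary {s} k i)

digit-injective : ∀ {s} (k l : Fin (2 ^ s)) →
  (∀ i → digit {s} k i ≡ digit {s} l i) → k ≡ l
digit-injective {s} k l same = binary-injective k l λ i → begin
  binary {s} k i                        ≡⟨ Inverse.strictlyInverseʳ 2↔Bool (binary {s} k i) ⟨
  Inverse.from 2↔Bool (digit {s} k i)   ≡⟨ cong (Inverse.from 2↔Bool) (same i) ⟩
  Inverse.from 2↔Bool (digit {s} l i)   ≡⟨ Inverse.strictlyInverseʳ 2↔Bool (binary {s} l i) ⟩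
  binary {s} l i                        ∎
  where open ≡-Reasoning

monochromatic? : ∀ {n} {C : Set} → DecidableEquality C →
  (f : Fin n → C) (e : Subset n) → Dec (Monochromatic f e)
monochromatic? _≟_ f e =
  all? λ u → all? λ v → (u ∈? e) →-dec ((v ∈? e) →-dec (f u ≟ f v))

coloring⇒cover : ∀ {n} (G : Hypergraph n) χ s → χ ≤ 2 ^ s →
  ProperColoring G χ → HasCoverOfSize G s
coloring⇒cover G χ s χ≤2ˢ (f , proper) = X , All.map separated proper
  where
  X : Family _ s
  X i v = digit {s} (inject≤ (f v) χ≤2ˢ) i

  allDigits⇒f : ∀ {e} → (∀ i → Monochromatic (X i) e) → Monochromatic f e
  allDigits⇒f mono u v u∈e v∈e =
    inject≤-injective χ≤2ˢ χ≤2ˢ (f u) (f v)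
      (digit-injective _ _ (λ i → mono i u v u∈e v∈e))

  separated : ∀ {e} → ¬ Monochromatic f e → ∃ λ i → ¬ Monochromatic (X i) e
  separated {e} notMono =
    ¬∀⟶∃¬ s (λ i → Monochromatic (X i) e)
      (λ i → monochromatic? Bool._≟_ (X i) e) (notMono ∘ allDigits⇒f)

power-of-two-between : ∀ m → ∃ λ s → suc m ≤ 2 ^ s × 2 ^ s ≤ 2 * suc m
power-of-two-between zero = 0 , s≤s z≤n , s≤s z≤n
power-of-two-between (suc m) with power-of-two-between m
... | s , lower , upper with suc (suc m) ≤? 2 ^ s
...   | yes lower′ = s , lower′ , ≤-trans upper (*-monoʳ-≤ 2 (n≤1+n (suc m)))
...   | no ¬lower′ =  -- then 2ˢ = m + 1, and s + 1 works
  suc s , subst (suc (suc m) ≤_) (sym 2ˢ⁺¹≡2[m+1]) m+1<2[m+1]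
        , subst (_≤ 2 * suc (suc m)) (sym 2ˢ⁺¹≡2[m+1]) (*-monoʳ-≤ 2 (n≤1+n (suc m)))
  where
  2ˢ≡m+1 : 2 ^ s ≡ suc m
  2ˢ≡m+1 = ≤-antisym (≤-pred (≰⇒> ¬lower′)) lower
  2ˢ⁺¹≡2[m+1] : 2 ^ suc s ≡ 2 * suc m
  2ˢ⁺¹≡2[m+1] = cong (2 *_) 2ˢ≡m+1
  m+1<2[m+1] : suc m < 2 * suc m
  m+1<2[m+1] = subst (_< 2 * suc m) (*-identityˡ (suc m)) (*-monoˡ-< (suc m) {1} {2} ≤-refl)

theorem8 : ∀ {n k} (G : Hypergraph n) → Uniform k G →
    ∀ χ t γ → IsChromaticNumber G χ → IsCoverNumber G t →
    IsCoverIndependence G t γ → n ≤ 2 * γ * χ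
-- With no vertices there is nothing to show, and a nonempty hypergraph
-- has no colouring with zero colours; otherwise chain the two bounds.
theorem8 {zero} _ _ _ _ _ _ _ _ = z≤n
theorem8 {suc n} G _ zero _ _ ((f , _) , _) _ _ with f fzero
... | ()
theorem8 {suc n} G _ χ@(suc m) t γ (proper , _) (_ , t-minimal) ((X , _ , _ , γ-maximal) , _)
  with power-of-two-between m
... | s , χ≤2ˢ , 2ˢ≤2χ = begin
  suc n         ≤⟨ vertex-bound X γ (λ b → γ-maximal _ (b , refl)) ⟩
  2 ^ t * γ     ≤⟨ *-monoˡ-≤ γ (^-monoʳ-≤ 2 t≤s) ⟩
  2 ^ s * γ     ≤⟨ *-monoˡ-≤ γ 2ˢ≤2χ ⟩
  2 * χ * γ     ≡⟨ *-assoc 2 χ γ ⟩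
  2 * (χ * γ)   ≡⟨ cong (2 *_) (*-comm χ γ) ⟩
  2 * (γ * χ)   ≡⟨ *-assoc 2 γ χ ⟨
  2 * γ * χ     ∎
  where
  open ≤-Reasoning
  t≤s : t ≤ s
  t≤s = t-minimal s (coloring⇒cover G χ s χ≤2ˢ proper)
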